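{- Let $f \in \mathbb{N}_0[x^{\pm 1}]$ with $f(1) > 3$ and $|\operatorname{supp}(f)| > 1$. Then $f = g + h$ for some irreducible elements $g, h$ of $\mathbb{N}_0[x^{\pm 1}]$.
   Context: $\mathbb{N}_0[x^{\pm 1}]$ denotes the commutative semiring of Laurent polynomials in $x$ with nonnegative integer coefficients, under the usual addition and multiplication. Its units are exactly the monomials $x^k$, $k \in \mathbb{Z}$. An element of $\mathbb{N}_0[x^{\pm 1}]$ is irreducible if it is nonzero, not a unit, and cannot be written as a product of two non-units of $\mathbb{N}_0[x^{\pm 1}]$. For $f = \sum_{i=0}^n c_i x^{k_i}$ with all $c_i$ positive integers and distinct exponents $k_i \in \mathbb{Z}$, the support of $f$ is $\operatorname{supp}(f) = \{k_0, \ldots, k_n\}$; $f(1)$ denotes the sum of the coefficients of $f$. -}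

module Defs where

-- Model of the semiring N₀[x^{±1}]:
-- an element  f = Σ c_k x^k  is represented by a finite multiset of exponents,
-- i.e. a list of integers in which k occurs exactly c_k times.
-- Two lists denote the same Laurent polynomial iff they are permutations of
-- each other (_↭_).

open import Data.Integer using (ℤ; _+_; +_)
open import Data.Nat using (ℕ)
open import Data.List using (List; []; _∷_; _++_; length; cartesianProductWith)
open import Data.List.Membership.Propositional using (_∈_)
open import Data.List.Relation.Binary.Permutation.Propositional using (_↭_)
open import Data.Product using (∃; ∃-syntax; _×_)
open import Data.Sum using (_⊎_)
open import Relation.Nullary using (¬_)
open import Relation.Binary.PropositionalEquality using (_≢_)

LPoly : Set
LPoly = List ℤ

_≈_ : LPoly → LPoly → Set
f ≈ g = f ↭ g

infix 4 _≈_
infixl 6 _⊕_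
infixl 7 _⊗_

_⊕_ : LPoly → LPoly → LPoly
f ⊕ g = f ++ g

_⊗_ : LPoly → LPoly → LPoly
f ⊗ g = cartesianProductWith _+_ f g

𝟘 : LPoly
𝟘 = []

𝟙 : LPoly
𝟙 = (+ 0) ∷ []

IsUnit : LPoly → Set
IsUnit u = ∃[ v ] (u ⊗ v ≈ 𝟙)

Irreducible : LPoly → Set
Irreducible f =
  ¬ (f ≈ 𝟘) × ¬ IsUnit f ×
  (∀ g h → f ≈ g ⊗ h → IsUnit g ⊎ IsUnit h)

-- f(1) = sum of coefficients = number of exponent occurrences
eval1 : LPoly → ℕ
eval1 = length

SuppGt1 : LPoly → Set
SuppGt1 f = ∃[ a ] ∃[ b ] (a ∈ f × b ∈ f × a ≢ b)

module Submission where

-- Let f = x ∷ W have at least two terms, and suppose x ∉ W + W − W. Then f is irreducible: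
-- if f = g ⊗ h with at least two terms in each factor, write x = a + b with a ∈ g, b ∈ h;
-- the cross terms a + b′, a′ + b, a′ + b′ then lie in W, while
-- (a + b′) + (a′ + b) = x + (a′ + b′). Binomials are irreducible for counting reasons.
-- Fix an exponent a and let 2ᵏ be the largest power of two dividing every w − a.
-- Modulo 2ᵏ⁺¹ the exponents form exactly two nonempty classes, and no exponent of one
-- class lies in W + W − W for W drawn from the other class. So f splits into two such
-- irreducible summands, each consisting of one term of one class and the remaining terms
-- of the other, or a binomial inside the larger class when the other is a singleton.

open import Defs
open import Data.Nat as ℕ using (ℕ; zero; suc; z≤n; s≤s; _>_)
import Data.Nat.Properties as ℕP
import Data.Nat.Divisibility as ℕD
open import Data.Integer as ℤ using (ℤ; +_; 0ℤ; _+_; _*_; -_; _-_)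
import Data.Integer.Properties as ℤP
import Data.Integer.DivMod as ℤDM
open import Data.Integer.Divisibility.Signed
  using (_∣_; divides; _∣?_; ∣m⇒∣-m; ∣m∣n⇒∣m+n; ∣m∣n⇒∣m-n; ∣⇒∣ᵤ)
open import Data.Integer.Tactic.RingSolver using (solve-∀)
open import Data.List using ([]; _∷_; _++_; map; length; filter)
open import Data.List.Properties
  using (length-++; length-map; cartesianProductWith-zeroʳ; partition-defn)
open import Data.List.Membership.Propositional using (_∈_; find)
open import Data.List.Membership.Propositional.Properties
  using (∈-∃++; ∈-cartesianProductWith⁻; ∈-filter⁺; ∈-filter⁻)
open import Data.List.Relation.Binary.Subset.Propositional using (_⊆_)
open import Data.List.Relation.Unary.All as All using (All)
open import Data.List.Relation.Unary.All.Properties using (¬All⇒Any¬)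
open import Data.List.Relation.Unary.Any using (here; there)
open import Data.List.Relation.Binary.Permutation.Propositional
  using (_↭_; prep; swap; ↭-refl; ↭-trans; ↭-sym; ↭-reflexive; ↭ₛ⇒↭)
open import Data.List.Relation.Binary.Permutation.Propositional.Properties
  using (↭-length; ++⁺; ++⁺ˡ; map⁺; shift; shifts; drop-∷; ∈-resp-↭; ++-comm)
import Data.List.Relation.Binary.Permutation.Setoid.Properties as ↭ₛ
open import Data.Product using (∃-syntax; _×_; _,_; proj₁; proj₂)
open import Data.Sum using (_⊎_; inj₁; inj₂) renaming (map to map-⊎)
open import Function using (_∘_)
open import Relation.Binary.Definitions using (_Respects_)
open import Relation.Binary.PropositionalEquality
  using (_≡_; _≢_; refl; sym; trans; cong; cong₂; subst; subst₂; setoid; module ≡-Reasoning)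
open import Relation.Nullary using (¬_; contradiction; yes; no)
open import Relation.Unary using (Decidable)
open import Relation.Unary.Properties using (∁?)

private
  variable
    X : Set

∈⇒↭∷ : ∀ {x : X} {xs} → x ∈ xs → ∃[ ys ] (xs ↭ x ∷ ys)
∈⇒↭∷ x∈xs with ys , zs , refl ← ∈-∃++ x∈xs = ys ++ zs , shift _ ys zs

∈⇒↭∷∷ : ∀ {x u u′ : X} {us} → x ∈ u ∷ u′ ∷ us → ∃[ y ] ∃[ ys ] (u ∷ u′ ∷ us ↭ x ∷ y ∷ ys)
∈⇒↭∷∷ x∈ with ∈⇒↭∷ x∈
... | y ∷ ys , p = y , ys , p
... | [] , p with ↭-length p
...   | ()

↭-filter-++-filter-∁ : ∀ {P : X → Set} (P? : Decidable P) xs →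
  xs ↭ filter P? xs ++ filter (∁? P?) xs
↭-filter-++-filter-∁ P? xs =
  subst (λ parts → xs ↭ proj₁ parts ++ proj₂ parts) (partition-defn P? xs)
        (↭ₛ⇒↭ (↭ₛ.partition-↭ (setoid _) P? xs))

⊗-congˡ : ∀ {f g} h → f ↭ g → f ⊗ h ↭ g ⊗ h
⊗-congˡ h (_↭_.refl) = ↭-refl
⊗-congˡ h (prep x p) = ++⁺ˡ (map (_+_ x) h) (⊗-congˡ h p)
⊗-congˡ h (swap x y p) =
  ↭-trans (shifts (map (_+_ x) h) (map (_+_ y) h))
          (++⁺ˡ (map (_+_ y) h) (++⁺ˡ (map (_+_ x) h) (⊗-congˡ h p)))
⊗-congˡ h (_↭_.trans p q) = ↭-trans (⊗-congˡ h p) (⊗-congˡ h q)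

⊗-congʳ : ∀ f {g h} → g ↭ h → f ⊗ g ↭ f ⊗ h
⊗-congʳ [] p = ↭-refl
⊗-congʳ (u ∷ f) p = ++⁺ (map⁺ (_+_ u) p) (⊗-congʳ f p)

length-⊗ : ∀ f g → length (f ⊗ g) ≡ length f ℕ.* length g
length-⊗ [] g = refl
length-⊗ (u ∷ f) g = begin
  length (map (_+_ u) g ++ f ⊗ g)          ≡⟨ length-++ (map (_+_ u) g) ⟩
  length (map (_+_ u) g) ℕ.+ length (f ⊗ g) ≡⟨ cong₂ ℕ._+_ (length-map (_+_ u) g) (length-⊗ f g) ⟩
  length g ℕ.+ length f ℕ.* length g       ∎
  where open ≡-Reasoning

⊗-cross-terms : ∀ a a′ f b b′ g →
  ∃[ R ] ((a ∷ a′ ∷ f) ⊗ (b ∷ b′ ∷ g) ↭ a + b ∷ a + b′ ∷ a′ + b ∷ a′ + b′ ∷ R)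
⊗-cross-terms a a′ f b b′ g =
  map (_+_ a) g ++ map (_+_ a′) g ++ f ⊗ (b ∷ b′ ∷ g) ,
  prep _ (prep _ (↭-trans (shift _ (map (_+_ a) g) _) (prep _ (shift _ (map (_+_ a) g) _))))

singleton-isUnit : ∀ u → IsUnit (u ∷ [])
singleton-isUnit u = - u ∷ [] , ↭-reflexive (cong (_∷ []) (ℤP.+-inverseʳ u))

irreducible-if-no-proper-factorisation : ∀ x y t →
  (∀ u u′ g v v′ k → ¬ x ∷ y ∷ t ≈ (u ∷ u′ ∷ g) ⊗ (v ∷ v′ ∷ k)) → Irreducible (x ∷ y ∷ t)
irreducible-if-no-proper-factorisation x y t no-factorisation = nonzero , nonunit , factors
  where
  nonzero : ¬ x ∷ y ∷ t ≈ 𝟘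
  nonzero p with ↭-length p
  ... | ()
  nonunit : ¬ IsUnit (x ∷ y ∷ t)
  nonunit (v , p)
    with ℕP.m*n≡1⇒m≡1 (length (x ∷ y ∷ t)) (length v)
                      (trans (sym (length-⊗ (x ∷ y ∷ t) v)) (↭-length p))
  ... | ()
  factors : ∀ g k → x ∷ y ∷ t ≈ g ⊗ k → IsUnit g ⊎ IsUnit k
  factors [] k p with ↭-length p
  ... | ()
  factors (u ∷ []) k p = inj₁ (singleton-isUnit u)
  factors (u ∷ u′ ∷ g) [] p
    with ↭-length (↭-trans p (↭-reflexive (cartesianProductWith-zeroʳ _+_ (u ∷ u′ ∷ g))))
  ... | ()
  factors (u ∷ u′ ∷ g) (v ∷ []) p = inj₂ (singleton-isUnit v)
  factors (u ∷ u′ ∷ g) (v ∷ v′ ∷ k) p = contradiction p (no-factorisation u u′ g v v′ k)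

length-proper-product : ∀ u u′ g v v′ k → 4 ℕ.≤ length ((u ∷ u′ ∷ g) ⊗ (v ∷ v′ ∷ k))
length-proper-product u u′ g v v′ k =
  subst (4 ℕ.≤_) (sym (length-⊗ (u ∷ u′ ∷ g) (v ∷ v′ ∷ k)))
        (ℕP.*-mono-≤ {2} {2 ℕ.+ length g} {2} {2 ℕ.+ length k} (s≤s (s≤s z≤n)) (s≤s (s≤s z≤n)))

binomial-irreducible : ∀ x y → Irreducible (x ∷ y ∷ [])
binomial-irreducible x y = irreducible-if-no-proper-factorisation x y [] λ u u′ g v v′ k p →
  contradiction (subst (4 ℕ.≤_) (sym (↭-length p)) (length-proper-product u u′ g v v′ k))
                λ { (s≤s (s≤s ())) }

OutsideSumDiff : ℤ → LPoly → Set
OutsideSumDiff x W = ∀ {w₁ w₂ w₃} → w₁ ∈ W → w₂ ∈ W → w₃ ∈ W → w₁ + w₂ ≢ x + w₃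

outsideSumDiff-⊆ : ∀ x {V W} → W ⊆ V → OutsideSumDiff x V → OutsideSumDiff x W
outsideSumDiff-⊆ x W⊆V outside w₁∈ w₂∈ w₃∈ = outside (W⊆V w₁∈) (W⊆V w₂∈) (W⊆V w₃∈)

cross-sum : ∀ a a′ b b′ → (a + b′) + (a′ + b) ≡ (a + b) + (a′ + b′)
cross-sum = solve-∀

outsideSumDiff-no-proper-factorisation : ∀ {x W} → OutsideSumDiff x W →
  ∀ u u′ g v v′ k → ¬ x ∷ W ≈ (u ∷ u′ ∷ g) ⊗ (v ∷ v′ ∷ k)
outsideSumDiff-no-proper-factorisation {W = W} outside u u′ g v v′ k p
  with a , b , a∈ , b∈ , refl ←
         ∈-cartesianProductWith⁻ _+_ (u ∷ u′ ∷ g) (v ∷ v′ ∷ k) (∈-resp-↭ p (here refl))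
  with a′ , G , pG ← ∈⇒↭∷∷ a∈
  with b′ , K , pK ← ∈⇒↭∷∷ b∈
  with R , pR ← ⊗-cross-terms a a′ G b b′ K
  = outside (∈W (here refl)) (∈W (there (here refl))) (∈W (there (there (here refl))))
            (cross-sum a a′ b b′)
  where
  ∈W : ∀ {w} → w ∈ a + b′ ∷ a′ + b ∷ a′ + b′ ∷ R → w ∈ W
  ∈W = ∈-resp-↭ (↭-sym (drop-∷ (↭-trans p (↭-trans (⊗-congˡ (v ∷ v′ ∷ k) pG)
                                            (↭-trans (⊗-congʳ (a ∷ a′ ∷ G) pK) pR)))))

outsideSumDiff-irreducible : ∀ x y t → OutsideSumDiff x (y ∷ t) → Irreducible (x ∷ y ∷ t)
outsideSumDiff-irreducible x y t outside =
  irreducible-if-no-proper-factorisation x y t (outsideSumDiff-no-proper-factorisation outside)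

sum-diff-shift : ∀ w₁ w₂ w₃ c → ((w₁ + - c) + (w₂ + - c)) + - (w₃ + - c) ≡ ((w₁ + w₂) + - w₃) + - c
sum-diff-shift = solve-∀

cancel-shift : ∀ x w c → ((x + w) + - w) + - c ≡ x + - c
cancel-shift = solve-∀

outsideSumDiff-if-incongruent : ∀ {N c x W} →
  (∀ {w} → w ∈ W → N ∣ w - c) → ¬ N ∣ x - c → OutsideSumDiff x W
outsideSumDiff-if-incongruent {N} {c} {x} W≡c N∤x-c {w₁} {w₂} {w₃} w₁∈ w₂∈ w₃∈ w₁+w₂≡x+w₃ =
  N∤x-c (subst (N ∣_) x-c≡ (∣m∣n⇒∣m-n (∣m∣n⇒∣m+n (W≡c w₁∈) (W≡c w₂∈)) (W≡c w₃∈)))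
  where
  open ≡-Reasoning
  x-c≡ : ((w₁ - c) + (w₂ - c)) - (w₃ - c) ≡ x - c
  x-c≡ = begin
    ((w₁ - c) + (w₂ - c)) - (w₃ - c) ≡⟨ sum-diff-shift w₁ w₂ w₃ c ⟩
    ((w₁ + w₂) - w₃) - c             ≡⟨ cong (λ s → (s - w₃) - c) w₁+w₂≡x+w₃ ⟩
    ((x + w₃) - w₃) - c              ≡⟨ cancel-shift x w₃ c ⟩
    x - c                            ∎

Separated : LPoly → LPoly → Set
Separated A B = ∀ {x} → x ∈ A → OutsideSumDiff x B

difference-of-shifts : ∀ x c d → (x + - d) + - (x + - c) ≡ c + - d
difference-of-shifts = solve-∀

separated-if-incongruent : ∀ {N c d A B} →
  (∀ {w} → w ∈ A → N ∣ w - c) → (∀ {w} → w ∈ B → N ∣ w - d) → ¬ N ∣ c - d → Separated A B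
separated-if-incongruent {N} {c} {d} A≡c B≡d N∤c-d {x} x∈A =
  outsideSumDiff-if-incongruent {x = x} B≡d λ N∣x-d →
    N∤c-d (subst (N ∣_) (difference-of-shifts x c d) (∣m∣n⇒∣m-n N∣x-d (A≡c x∈A)))

SumOfTwoIrreducibles : LPoly → Set
SumOfTwoIrreducibles f = ∃[ g ] ∃[ h ] (Irreducible g × Irreducible h × f ≈ g ⊕ h)

sumOfTwoIrreducibles-resp-↭ : SumOfTwoIrreducibles Respects _↭_
sumOfTwoIrreducibles-resp-↭ f↭f′ (g , h , irr-g , irr-h , f≈g⊕h) =
  g , h , irr-g , irr-h , ↭-trans (↭-sym f↭f′) f≈g⊕h

split-singleton : ∀ a b b₁ b₂ B → Separated (a ∷ []) (b ∷ b₁ ∷ b₂ ∷ B) →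
  SumOfTwoIrreducibles (a ∷ b ∷ b₁ ∷ b₂ ∷ B)
split-singleton a b b₁ b₂ B sep =
  b ∷ b₁ ∷ [] , a ∷ b₂ ∷ B ,
  binomial-irreducible b b₁ ,
  outsideSumDiff-irreducible a b₂ B (outsideSumDiff-⊆ a (there ∘ there) (sep (here refl))) ,
  ↭-trans (swap a b ↭-refl) (prep b (swap a b₁ ↭-refl))

split-crosswise : ∀ a a₁ A b b₁ B →
  Separated (a ∷ a₁ ∷ A) (b ∷ b₁ ∷ B) → Separated (b ∷ b₁ ∷ B) (a ∷ a₁ ∷ A) →
  SumOfTwoIrreducibles (a ∷ a₁ ∷ A ++ b ∷ b₁ ∷ B)
split-crosswise a a₁ A b b₁ B sepAB sepBA =
  b ∷ a₁ ∷ A , a ∷ b₁ ∷ B ,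
  outsideSumDiff-irreducible b a₁ A (outsideSumDiff-⊆ b there (sepBA (here refl))) ,
  outsideSumDiff-irreducible a b₁ B (outsideSumDiff-⊆ a there (sepAB (here refl))) ,
  ↭-trans (prep a (shift b (a₁ ∷ A) (b₁ ∷ B)))
          (↭-trans (swap a b ↭-refl) (prep b (↭-sym (shift a (a₁ ∷ A) (b₁ ∷ B)))))

split-separated : ∀ {a b} A B → a ∈ A → b ∈ B → Separated A B → Separated B A →
  3 ℕ.< length (A ++ B) → SumOfTwoIrreducibles (A ++ B)
split-separated [] B () _ _ _ _
split-separated (a ∷ A) [] _ () _ _ _
split-separated (a ∷ []) (b ∷ []) _ _ _ _ (s≤s (s≤s ()))
split-separated (a ∷ []) (b ∷ b₁ ∷ []) _ _ _ _ (s≤s (s≤s (s≤s ())))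
split-separated (a ∷ []) (b ∷ b₁ ∷ b₂ ∷ B) _ _ sepAB _ _ = split-singleton a b b₁ b₂ B sepAB
split-separated (a ∷ a₁ ∷ []) (b ∷ []) _ _ _ _ (s≤s (s≤s (s≤s ())))
split-separated (a ∷ a₁ ∷ a₂ ∷ A) (b ∷ []) _ _ _ sepBA _ =
  sumOfTwoIrreducibles-resp-↭ (++-comm (b ∷ []) (a ∷ a₁ ∷ a₂ ∷ A))
                              (split-singleton b a a₁ a₂ A sepBA)
split-separated (a ∷ a₁ ∷ A) (b ∷ b₁ ∷ B) _ _ sepAB sepBA _ =
  split-crosswise a a₁ A b b₁ B sepAB sepBA

neg-minus : ∀ x y → - (x + - y) ≡ y + - x
neg-minus = solve-∀

split-by-congruence : ∀ {N a b f} → a ∈ f → b ∈ f → ¬ N ∣ b - a →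
  (∀ {w} → w ∈ f → N ∣ w - a ⊎ N ∣ w - b) → 3 ℕ.< length f → SumOfTwoIrreducibles f
split-by-congruence {N} {a} {b} {f} a∈f b∈f N∤b-a classes 3<|f| =
  sumOfTwoIrreducibles-resp-↭ (↭-sym f↭A++B)
    (split-separated A B a∈A b∈B
      (separated-if-incongruent A≡a B≡b
        λ N∣a-b → N∤b-a (subst (N ∣_) (neg-minus a b) (∣m⇒∣-m N∣a-b)))
      (separated-if-incongruent B≡b A≡a N∤b-a)
      (subst (3 ℕ.<_) (↭-length f↭A++B) 3<|f|))
  where
  P? : Decidable (λ w → N ∣ w - a)
  P? w = N ∣? w - a
  A B : LPoly
  A = filter P? f
  B = filter (∁? P?) f
  f↭A++B : f ↭ A ++ B
  f↭A++B = ↭-filter-++-filter-∁ P? f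
  A≡a : ∀ {w} → w ∈ A → N ∣ w - a
  A≡a w∈A = proj₂ (∈-filter⁻ P? {xs = f} w∈A)
  B≡b : ∀ {w} → w ∈ B → N ∣ w - b
  B≡b w∈B with w∈f , N∤w-a ← ∈-filter⁻ (∁? P?) w∈B with classes w∈f
  ... | inj₁ N∣w-a = contradiction N∣w-a N∤w-a
  ... | inj₂ N∣w-b = N∣w-b
  a∈A : a ∈ A
  a∈A = ∈-filter⁺ P? a∈f (divides 0ℤ (trans (ℤP.+-inverseʳ a) (sym (ℤP.*-zeroˡ N))))
  b∈B : b ∈ B
  b∈B = ∈-filter⁺ (∁? P?) b∈f N∤b-a

pow₂ : ℕ → ℤ
pow₂ k = + (2 ℕ.^ k)

n<2^n : ∀ n → n ℕ.< 2 ℕ.^ n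
n<2^n zero = s≤s z≤n
n<2^n (suc n) = ℕP.+-mono-≤ (ℕP.m^n>0 2 n) (ℕP.≤-trans (n<2^n n) (ℕP.m≤m+n _ 0))

decidable-boundary : ∀ {P : ℕ → Set} → Decidable P → P 0 → ∀ K → ¬ P K → ∃[ k ] (P k × ¬ P (suc k))
decidable-boundary P? P0 zero ¬P0 = contradiction P0 ¬P0
decidable-boundary P? P0 (suc K) ¬PK+1 with P? K
... | yes PK = K , PK , ¬PK+1
... | no ¬PK = decidable-boundary P? P0 K ¬PK

largest-power-of-two-dividing-differences : ∀ {a b f} → b ∈ f → a ≢ b →
  ∃[ k ] (All (λ w → pow₂ k ∣ w - a) f × ¬ All (λ w → pow₂ (suc k) ∣ w - a) f)
largest-power-of-two-dividing-differences {a} {b} {f} b∈f a≢b =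
  decidable-boundary (λ k → All.all? (λ w → pow₂ k ∣? w - a) f) all-1 K ¬all-K
  where
  K : ℕ
  K = ℤ.∣ b - a ∣
  all-1 : All (λ w → pow₂ 0 ∣ w - a) f
  all-1 = All.tabulate λ {w} _ → divides (w - a) (sym (ℤP.*-identityʳ (w - a)))
  instance
    K≢0 : ℕ.NonZero K
    K≢0 = ℕ.≢-nonZero λ K≡0 → a≢b (sym (ℤP.i-j≡0⇒i≡j b a (ℤP.∣i∣≡0⇒i≡0 K≡0)))
  ¬all-K : ¬ All (λ w → pow₂ K ∣ w - a) f
  ¬all-K all-K = ℕP.<⇒≱ (n<2^n K) (ℕD.∣⇒≤ (∣⇒∣ᵤ (All.lookup all-K b∈f)))

even-or-odd : ∀ q → ∃[ s ] (q ≡ s * + 2 ⊎ q ≡ + 1 + s * + 2)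
even-or-odd q = by-remainder (q ℤ.%ℕ 2) (q ℤ./ℕ 2) (ℤDM.n%ℕd<d q 2) (ℤDM.a≡a%ℕn+[a/ℕn]*n q 2)
  where
  by-remainder : ∀ m s → m ℕ.< 2 → q ≡ + m + s * + 2 → ∃[ s ] (q ≡ s * + 2 ⊎ q ≡ + 1 + s * + 2)
  by-remainder 0 s _ q≡ = s , inj₁ (trans q≡ (ℤP.+-identityˡ (s * + 2)))
  by-remainder 1 s _ q≡ = s , inj₂ q≡
  by-remainder (suc (suc _)) s (s≤s (s≤s ())) q≡

even-multiple : ∀ s M → (s * + 2) * M ≡ s * (+ 2 * M)
even-multiple = solve-∀

odd-difference : ∀ s s′ M → (+ 1 + s * + 2) * M + - ((+ 1 + s′ * + 2) * M) ≡ (s + - s′) * (+ 2 * M)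
odd-difference = solve-∀

doubling-dichotomy : ∀ {M x y} → M ∣ x → M ∣ y → ¬ (+ 2 * M) ∣ y → (+ 2 * M) ∣ x ⊎ (+ 2 * M) ∣ x - y
doubling-dichotomy {M} (divides q refl) (divides r refl) 2M∤y with even-or-odd q | even-or-odd r
... | s , inj₁ refl | _ = inj₁ (divides s (even-multiple s M))
... | _ | s , inj₁ refl = contradiction (divides s (even-multiple s M)) 2M∤y
... | s , inj₂ refl | s′ , inj₂ refl = inj₂ (divides (s - s′) (odd-difference s s′ M))

difference-of-differences : ∀ w a b → (w + - a) + - (b + - a) ≡ w + - b
difference-of-differences = solve-∀

two-classes : ∀ {k a b w} → pow₂ k ∣ w - a → pow₂ k ∣ b - a → ¬ pow₂ (suc k) ∣ b - a →
  pow₂ (suc k) ∣ w - a ⊎ pow₂ (suc k) ∣ w - b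
two-classes {k} {a} {b} {w} 2ᵏ∣w-a 2ᵏ∣b-a 2ᵏ⁺¹∤b-a =
  map-⊎ (subst (_∣ w - a) double) (subst₂ _∣_ double (difference-of-differences w a b))
        (doubling-dichotomy 2ᵏ∣w-a 2ᵏ∣b-a (2ᵏ⁺¹∤b-a ∘ subst (_∣ b - a) double))
  where
  double : + 2 * pow₂ k ≡ pow₂ (suc k)
  double = sym (ℤP.pos-* 2 (2 ℕ.^ k))

two-adic-split : ∀ {a b f} → b ∈ f → a ≢ b →
  ∃[ N ] ∃[ b′ ] (b′ ∈ f × ¬ N ∣ b′ - a × (∀ {w} → w ∈ f → N ∣ w - a ⊎ N ∣ w - b′))
two-adic-split {a} {f = f} b∈f a≢b
  with k , all-k , ¬all-k+1 ← largest-power-of-two-dividing-differences b∈f a≢b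
  with b′ , b′∈f , ∤b′-a ← find (¬All⇒Any¬ (λ w → pow₂ (suc k) ∣? w - a) f ¬all-k+1)
  = pow₂ (suc k) , b′ , b′∈f , ∤b′-a ,
    λ {w} w∈f → two-classes {k} {a} {b′} {w}
                  (All.lookup all-k w∈f) (All.lookup all-k b′∈f) ∤b′-a

theorem1p1 : (f : LPoly) → eval1 f > 3 → SuppGt1 f →
    ∃[ g ] ∃[ h ] (Irreducible g × Irreducible h × f ≈ g ⊕ h)
theorem1p1 f 3<|f| (a , b , a∈f , b∈f , a≢b) =
  let N , b′ , b′∈f , N∤b′-a , classes = two-adic-split b∈f a≢b
  in split-by-congruence a∈f b′∈f N∤b′-a classes 3<|f|
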